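{- Let $n\ge 1$ and $h\ge 1$ be integers. There is a bijection between the set of Dyck paths of length $2n$ with a marked peak of height $h$ and the set of Dyck bridges of length $2n$ whose first step is $\mathtt d$ and which have exactly $h-1$ crossings of the $x$-axis. Consequently, the total number of peaks in all Dyck paths of length $2n$ equals $\binom{2n-1}{n}$.
   Context: Paths consist of steps $\mathtt u=(1,1)$ and $\mathtt d=(1,-1)$ and start at the origin. A Dyck path of length $2n$ is such a path of $2n$ steps that ends on the $x$-axis and never goes below the $x$-axis. A Dyck bridge of length $2n$ is such a path of $2n$ steps ending on the $x$-axis, with no other constraint (it may go below the $x$-axis). A peak is an occurrence of two consecutive steps $\mathtt u\mathtt d$; its height is the $y$-coordinate of the vertex between these two steps. A Dyck path with a marked peak is a Dyck path together with a distinguished one of its peaks (the same path with different marked peaks gives different objects). If $S_t$ denotes the height of the path after $t$ steps, a crossing of the $x$-axis is a time $t$ with $0<t<2n$, $S_t=0$ and $S_{t-1}S_{t+1}<0$ (i.e., the path passes from strictly one side of the $x$-axis to strictly the other side). -}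

module Defs where

open import Data.Nat using (ℕ; zero; suc; _+_; _*_; _∸_; _<_)
open import Data.Integer as ℤ using (ℤ; +_; -[1+_]; _≤ᵇ_)
open import Data.Bool using (Bool; true; false; _∧_; _∨_; not; T; if_then_else_)
open import Data.Vec using (Vec; []; _∷_)
open import Data.List using (List; []; _∷_; map; _++_; length; filter)
open import Data.Nat.ListAction using (sum)
open import Data.Fin using (Fin)
open import Data.Product using (Σ; _×_; _,_)
open import Relation.Binary.PropositionalEquality using (_≡_)

data Step : Set where
  u d : Step

stepVal : Step → ℤ
stepVal u = + 1
stepVal d = -[1+ 0 ]

Path : ℕ → Set
Path m = Vec Step m

-- list of heights S_1, …, S_m starting from height s (S_0 = s is not included)
heightsFrom : ∀ {m} → ℤ → Path m → List ℤ
heightsFrom s [] = []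
heightsFrom s (x ∷ p) = (s ℤ.+ stepVal x) ∷ heightsFrom (s ℤ.+ stepVal x) p

heights : ∀ {m} → Path m → List ℤ
heights p = + 0 ∷ heightsFrom (+ 0) p

endHeight : ∀ {m} → ℤ → Path m → ℤ
endHeight s [] = s
endHeight s (x ∷ p) = endHeight (s ℤ.+ stepVal x) p

isZero : ℤ → Bool
isZero (+ 0) = true
isZero _ = false

allNonneg : List ℤ → Bool
allNonneg [] = true
allNonneg (z ∷ zs) = (+ 0 ≤ᵇ z) ∧ allNonneg zs

isDyck : ∀ {m} → Path m → Bool
isDyck p = isZero (endHeight (+ 0) p) ∧ allNonneg (heights p)

isBridge : ∀ {m} → Path m → Bool
isBridge p = isZero (endHeight (+ 0) p)

firstIsD : ∀ {m} → Path m → Bool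
firstIsD [] = false
firstIsD (u ∷ p) = false
firstIsD (d ∷ p) = true

peakHeightsFrom : ∀ {m} → ℤ → Path m → List ℤ
peakHeightsFrom s [] = []
peakHeightsFrom s (u ∷ []) = []
peakHeightsFrom s (u ∷ (u ∷ p)) = peakHeightsFrom (s ℤ.+ + 1) (u ∷ p)
peakHeightsFrom s (u ∷ (d ∷ p)) = (s ℤ.+ + 1) ∷ peakHeightsFrom (s ℤ.+ + 1) (d ∷ p)
peakHeightsFrom s (d ∷ p) = peakHeightsFrom (s ℤ.+ -[1+ 0 ]) p

peakHeights : ∀ {m} → Path m → List ℤ
peakHeights p = peakHeightsFrom (+ 0) p

numPeaks : ∀ {m} → Path m → ℕ
numPeaks p = length (peakHeights p)

-- A marked peak of height h: an index into the list of peaks whose height is h.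
-- (Distinct peaks give distinct indices.)
lookupL : (xs : List ℤ) → Fin (length xs) → ℤ
lookupL (x ∷ xs) Fin.zero = x
lookupL (x ∷ xs) (Fin.suc i) = lookupL xs i

oppSigns : ℤ → ℤ → Bool
oppSigns a b = ((+ 1 ≤ᵇ a) ∧ (b ≤ᵇ -[1+ 0 ])) ∨ ((a ≤ᵇ -[1+ 0 ]) ∧ (+ 1 ≤ᵇ b))

crossingsL : List ℤ → ℕ
crossingsL (a ∷ b ∷ c ∷ zs) =
  (if isZero b ∧ oppSigns a c then 1 else 0) + crossingsL (b ∷ c ∷ zs)
crossingsL _ = 0

crossings : ∀ {m} → Path m → ℕ
crossings p = crossingsL (heights p)

MarkedDyck : ℕ → ℕ → Set
MarkedDyck n h =
  Σ (Path (2 * n)) λ p → T (isDyck p) ×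
    Σ (Fin (numPeaks p)) λ i → lookupL (peakHeights p) i ≡ + h

DBridge : ℕ → ℕ → Set
DBridge n k =
  Σ (Path (2 * n)) λ p → T (isBridge p) × T (firstIsD p) × crossings p ≡ k

allPaths : (m : ℕ) → List (Path m)
allPaths zero = [] ∷ []
allPaths (suc m) = map (u ∷_) (allPaths m) ++ map (d ∷_) (allPaths m)

totalPeaks : ℕ → ℕ
totalPeaks n = sum (map numPeaks (filter (λ p → T? (isDyck p)) (allPaths (2 * n))))
  where
    open import Relation.Nullary.Decidable using (Dec)
    open import Data.Bool.Properties using (T?)

{-# OPTIONS --safe #-}
-- Cut a Dyck path at its marked peak, P = A u d B, the peak being at height k + 1.
-- Reversed and flipped, A becomes a path from height k down to 0, so that, read from
-- height 2k + 1, the path reverseFlip A · d · B stays weakly above the axis, ends on it,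
-- and first goes below k + 1 at the inserted step d; conversely every such path splits
-- uniquely at that first passage.  A letter-to-letter transducer then maps the
-- nonnegative paths from 2k + 1 to 0 bijectively onto paths from -1 to 0: writing W for
-- the height of the input and M for its running minimum, the output sits at height
-- ±(W - 2⌊M/2⌋) and changes side exactly when M drops to an odd level, which happens k
-- times.  Prefixing a step d gives a bridge with k crossings.  Forgetting the heights,
-- peaks of Dyck paths of length 2n are as many as bridges of length 2n starting with d,
-- that is, as paths of length 2n - 1 with n up-steps.
module Submission where

open import Defs
open import Axiom.UniquenessOfIdentityProofs using (module Decidable⇒UIP)
open import Data.Bool using (Bool; true; false; _∧_; not; T; if_then_else_)
open import Data.Bool.Properties as Bool using (T-irrelevant; T-∧; T?)
open import Data.Fin using (Fin; zero; suc)
import Data.Fin.Properties as Fin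
open import Data.Fin.Permutation using (↔⇒≡)
open import Data.Integer as ℤ using (ℤ; +_; -[1+_])
open import Data.Integer.Properties as ℤ using ()
open import Algebra.Properties.AbelianGroup ℤ.+-0-abelianGroup using ()
  renaming (identityˡ-unique to ℤ-identityˡ-unique)
open import Data.List using (List; []; _∷_; _++_; _∷ʳ_; length; map; reverse; filter)
import Data.List.Properties as List
open import Data.Nat as ℕ using (ℕ; zero; suc; _+_; _*_; _∸_; _≥_; _≡ᵇ_)
open import Data.Nat.Combinatorics using (_C_; nCk+nC[k+1]≡[n+1]C[k+1])
open import Data.Nat.ListAction using (sum)
open import Data.Nat.ListAction.Properties using (sum-++)
import Data.Nat.Properties as ℕ
open import Data.Product using (Σ; Σ-syntax; _×_; _,_; proj₁; proj₂; map₁)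
open import Data.Product.Algebra using (×-assoc)
open import Data.Product.Function.Dependent.Propositional using (Σ-↔)
open import Data.Product.Function.NonDependent.Propositional using (_×-↔_)
open import Data.Sum using (_⊎_; inj₁; inj₂)
open import Data.Sum.Function.Propositional using (_⊎-↔_)
open import Data.Unit using (⊤; tt)
open import Data.Vec using (Vec; []; _∷_; fromList; toList)
import Data.Vec.Properties as Vec
open import Function using (id; _∘_; _⇔_; _↔_; _⤖_; Equivalence; Inverse; mk↔ₛ′; mk⇔)
open import Function.Properties.Inverse using (↔-refl; ↔-sym; ↔-trans; ↔⇒⤖)
open import Function.Related.Propositional as Related using ()
open import Relation.Binary.PropositionalEquality
open import Relation.Nullary using (Irrelevant)

×-irrelevant : ∀ {A B : Set} → Irrelevant A → Irrelevant B → Irrelevant (A × B)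
×-irrelevant irrA irrB (a , b) (a′ , b′) = cong₂ _,_ (irrA a a′) (irrB b b′)

Σ-≡-irrelevant : ∀ {X : Set} {P : X → Set} → (∀ {x} → Irrelevant (P x)) →
  {a b : Σ X P} → proj₁ a ≡ proj₁ b → a ≡ b
Σ-≡-irrelevant irr {x , p} {.x , p′} refl = cong (x ,_) (irr p p′)

Σ-restrict : ∀ {X Y : Set} {P : X → Set} {Q : Y → Set} (f : X → Y) (g : Y → X) →
  (∀ x → P x → Q (f x)) → (∀ y → Q y → P (g y)) →
  (∀ x → P x → g (f x) ≡ x) → (∀ y → Q y → f (g y) ≡ y) →
  (∀ x → Irrelevant (P x)) → (∀ y → Irrelevant (Q y)) →
  Σ X P ↔ Σ Y Q
Σ-restrict f g f-ok g-ok g∘f f∘g P-irr Q-irr = mk↔ₛ′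
  (λ (x , p) → f x , f-ok x p) (λ (y , q) → g y , g-ok y q)
  (λ (y , q) → Σ-≡-irrelevant (Q-irr _) (f∘g y q)) (λ (x , p) → Σ-≡-irrelevant (P-irr _) (g∘f x p))

Σ-contract : ∀ {X Y : Set} (f : X → Y) (R : Y → Set) →
  Σ X (R ∘ f) ↔ Σ Y (λ y → R y × Σ[ x ∈ X ] f x ≡ y)
Σ-contract f R = mk↔ₛ′ (λ (x , r) → f x , r , x , refl) (λ { (_ , r , x , refl) → x , r })
  (λ { (_ , r , x , refl) → refl }) (λ (x , r) → refl)

list↔Σvec : ∀ {A : Set} → List A ↔ Σ ℕ (Vec A)
list↔Σvec = mk↔ₛ′ (λ P → length P , fromList P) (toList ∘ proj₂)
  (λ (k , v) → fromList∘toList v) Vec.toList∘fromList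
  where
    fromList∘toList : ∀ {A : Set} {k} (v : Vec A k) → (length (toList v) , fromList (toList v)) ≡ (k , v)
    fromList∘toList []      = refl
    fromList∘toList (x ∷ v) = cong (λ (k , v) → suc k , x ∷ v) (fromList∘toList v)

vec↔list : ∀ {A : Set} {m} (F : ∀ {k} → Vec A k → Set) →
  Σ (List A) (λ P → length P ≡ m × F (fromList P)) ↔ Σ (Vec A m) F
vec↔list {A} {m} F = ↔-trans (Σ-↔ list↔Σvec ↔-refl) Σvec↔vec
  where
    Σvec↔vec : Σ (Σ ℕ (Vec A)) (λ (k , v) → k ≡ m × F v) ↔ Σ (Vec A m) F
    Σvec↔vec = mk↔ₛ′ (λ { ((_ , v) , refl , x) → v , x }) (λ (v , x) → (m , v) , refl , x)
      (λ _ → refl) (λ { ((_ , v) , refl , x) → refl })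

Fin-if : ∀ b k → Fin (if b then k else 0) ↔ (T b × Fin k)
Fin-if true  k = mk↔ₛ′ (tt ,_) proj₂ (λ _ → refl) (λ _ → refl)
Fin-if false k = mk↔ₛ′ (λ ()) (λ ()) (λ ()) (λ ())

sum-filter : ∀ {A : Set} (P : A → Bool) (f : A → ℕ) xs →
  sum (map f (filter (T? ∘ P) xs)) ≡ sum (map (λ x → if P x then f x else 0) xs)
sum-filter P f []       = refl
sum-filter P f (x ∷ xs) with P x
... | true  = cong (f x ℕ.+_) (sum-filter P f xs)
... | false = sum-filter P f xs

isZero⇒≡0 : ∀ {z} → T (isZero z) → z ≡ + 0
isZero⇒≡0 {+ zero} _ = refl

flipStep : Step → Step
flipStep u = d
flipStep d = u

flipStep-involutive : ∀ x → flipStep (flipStep x) ≡ x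
flipStep-involutive u = refl
flipStep-involutive d = refl

stepVal-flipStep : ∀ s x → s ℤ.+ stepVal x ℤ.+ stepVal (flipStep x) ≡ s
stepVal-flipStep s u = trans (ℤ.+-assoc s (+ 1) -[1+ 0 ]) (ℤ.+-identityʳ s)
stepVal-flipStep s d = trans (ℤ.+-assoc s -[1+ 0 ] (+ 1)) (ℤ.+-identityʳ s)

endHeight-++ : ∀ s A B →
  endHeight s (fromList (A ++ B)) ≡ endHeight (endHeight s (fromList A)) (fromList B)
endHeight-++ s []      B = refl
endHeight-++ s (x ∷ A) B = endHeight-++ _ A B

heightsFrom-++ : ∀ s A B → heightsFrom s (fromList (A ++ B)) ≡
  heightsFrom s (fromList A) ++ heightsFrom (endHeight s (fromList A)) (fromList B)
heightsFrom-++ s []      B = refl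
heightsFrom-++ s (x ∷ A) B = cong (_ ∷_) (heightsFrom-++ _ A B)

allNonneg-++ : ∀ xs ys → allNonneg (xs ++ ys) ≡ allNonneg xs ∧ allNonneg ys
allNonneg-++ []       ys = refl
allNonneg-++ (z ∷ xs) ys =
  trans (cong (_ ∧_) (allNonneg-++ xs ys)) (sym (Bool.∧-assoc (+ 0 ℤ.≤ᵇ z) (allNonneg xs) (allNonneg ys)))

allNonneg-reverse : ∀ xs → allNonneg (reverse xs) ≡ allNonneg xs
allNonneg-reverse []       = refl
allNonneg-reverse (z ∷ xs) = begin
  allNonneg (reverse (z ∷ xs))                ≡⟨ cong allNonneg (List.unfold-reverse z xs) ⟩
  allNonneg (reverse xs ∷ʳ z)                 ≡⟨ allNonneg-++ (reverse xs) (z ∷ []) ⟩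
  allNonneg (reverse xs) ∧ allNonneg (z ∷ []) ≡⟨ cong₂ _∧_ (allNonneg-reverse xs) (Bool.∧-identityʳ _) ⟩
  allNonneg xs ∧ (+ 0 ℤ.≤ᵇ z)                 ≡⟨ Bool.∧-comm (allNonneg xs) _ ⟩
  allNonneg (z ∷ xs)                          ∎
  where open ≡-Reasoning

reverseFlip : List Step → List Step
reverseFlip = reverse ∘ map flipStep

reverseFlip-∷ : ∀ x A → reverseFlip (x ∷ A) ≡ reverseFlip A ∷ʳ flipStep x
reverseFlip-∷ x A = List.unfold-reverse (flipStep x) (map flipStep A)

reverseFlip-involutive : ∀ A → reverseFlip (reverseFlip A) ≡ A
reverseFlip-involutive A = begin
  reverse (map flipStep (reverse (map flipStep A))) ≡⟨ cong reverse (List.reverse-map flipStep (map flipStep A)) ⟩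
  reverse (reverse (map flipStep (map flipStep A))) ≡⟨ List.reverse-involutive _ ⟩
  map flipStep (map flipStep A)                     ≡⟨ List.map-∘ A ⟨
  map (flipStep ∘ flipStep) A                       ≡⟨ List.map-cong flipStep-involutive A ⟩
  map id A                                          ≡⟨ List.map-id A ⟩
  A                                                 ∎
  where open ≡-Reasoning

length-reverseFlip : ∀ A → length (reverseFlip A) ≡ length A
length-reverseFlip A = trans (List.length-reverse (map flipStep A)) (List.length-map flipStep A)

endHeight-reverseFlip : ∀ s A → endHeight (endHeight s (fromList A)) (fromList (reverseFlip A)) ≡ s
endHeight-reverseFlip s []      = refl
endHeight-reverseFlip s (x ∷ A) = begin
  endHeight e (fromList (reverseFlip (x ∷ A)))          ≡⟨ cong (endHeight e ∘ fromList) (reverseFlip-∷ x A) ⟩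
  endHeight e (fromList (reverseFlip A ∷ʳ flipStep x))  ≡⟨ endHeight-++ e (reverseFlip A) _ ⟩
  endHeight (endHeight e (fromList (reverseFlip A))) (flipStep x ∷ [])
    ≡⟨ cong (λ t → t ℤ.+ stepVal (flipStep x)) (endHeight-reverseFlip (s ℤ.+ stepVal x) A) ⟩
  s ℤ.+ stepVal x ℤ.+ stepVal (flipStep x)              ≡⟨ stepVal-flipStep s x ⟩
  s                                                     ∎
  where
    open ≡-Reasoning
    e = endHeight (s ℤ.+ stepVal x) (fromList A)

heightsFrom-reverseFlip : ∀ s A → let e = endHeight s (fromList A) in
  e ∷ heightsFrom e (fromList (reverseFlip A)) ≡ reverse (s ∷ heightsFrom s (fromList A))
heightsFrom-reverseFlip s []      = refl
heightsFrom-reverseFlip s (x ∷ A) = begin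
  e ∷ heightsFrom e (fromList (reverseFlip (x ∷ A)))
    ≡⟨ cong (λ B → e ∷ heightsFrom e (fromList B)) (reverseFlip-∷ x A) ⟩
  e ∷ heightsFrom e (fromList (reverseFlip A ∷ʳ flipStep x))
    ≡⟨ cong (e ∷_) (heightsFrom-++ e (reverseFlip A) _) ⟩
  e ∷ (heightsFrom e (fromList (reverseFlip A)) ++ heightsFrom (endHeight e (fromList (reverseFlip A))) (flipStep x ∷ []))
    ≡⟨ cong (λ t → e ∷ (heightsFrom e (fromList (reverseFlip A)) ++ heightsFrom t (flipStep x ∷ [])))
            (endHeight-reverseFlip s′ A) ⟩
  (e ∷ heightsFrom e (fromList (reverseFlip A))) ∷ʳ (s′ ℤ.+ stepVal (flipStep x))
    ≡⟨ cong₂ _∷ʳ_ (heightsFrom-reverseFlip s′ A) (stepVal-flipStep s x) ⟩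
  reverse (s′ ∷ heightsFrom s′ (fromList A)) ∷ʳ s
    ≡⟨ List.unfold-reverse s (s′ ∷ heightsFrom s′ (fromList A)) ⟨
  reverse (s ∷ heightsFrom s (fromList (x ∷ A)))
    ∎
  where
    open ≡-Reasoning
    s′ = s ℤ.+ stepVal x
    e = endHeight s′ (fromList A)

descendsFrom : ℕ → List Step → Bool
descendsFrom t       (u ∷ w) = descendsFrom (suc t) w
descendsFrom zero    []      = true
descendsFrom (suc t) []      = false
descendsFrom zero    (d ∷ w) = false
descendsFrom (suc t) (d ∷ w) = descendsFrom t w

descendsFrom-spec : ∀ t w → descendsFrom t w ≡
  isZero (endHeight (+ t) (fromList w)) ∧ allNonneg (heightsFrom (+ t) (fromList w))
descendsFrom-spec t       (u ∷ w) =
  trans (descendsFrom-spec (suc t) w)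
        (cong (λ s → isZero (endHeight s (fromList w)) ∧ allNonneg (s ∷ heightsFrom s (fromList w)))
              (cong +_ (ℕ.+-comm 1 t)))
descendsFrom-spec zero    []      = refl
descendsFrom-spec (suc t) []      = refl
descendsFrom-spec zero    (d ∷ w) = sym (Bool.∧-zeroʳ _)
descendsFrom-spec (suc t) (d ∷ w) = descendsFrom-spec t w

descendsFrom⇒endHeight≡0 : ∀ t w → T (descendsFrom t w) → endHeight (+ t) (fromList w) ≡ + 0
descendsFrom⇒endHeight≡0 t w h =
  isZero⇒≡0 (proj₁ (Equivalence.to (T-∧ {isZero (endHeight (+ t) (fromList w))}) (subst T (descendsFrom-spec t w) h)))

splitAtFirstPassage : ℕ → List Step → List Step × List Step
splitAtFirstPassage t       (u ∷ w) = map₁ (u ∷_) (splitAtFirstPassage (suc t) w)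
splitAtFirstPassage t       []      = [] , []
splitAtFirstPassage zero    (d ∷ w) = [] , w
splitAtFirstPassage (suc t) (d ∷ w) = map₁ (d ∷_) (splitAtFirstPassage t w)

FirstPassage : ℕ → ℕ → List Step → List Step × List Step → Set
FirstPassage t j w (x , y) = x ++ d ∷ y ≡ w × T (descendsFrom t x) × T (descendsFrom j y)

splitAtFirstPassage-correct : ∀ t j w → T (descendsFrom (suc (t + j)) w) →
  FirstPassage t j w (splitAtFirstPassage t w)
splitAtFirstPassage-correct t j (u ∷ w) h
  with splitAtFirstPassage (suc t) w | splitAtFirstPassage-correct (suc t) j w h
... | x , y | x++dy≡w , dx , dy = cong (u ∷_) x++dy≡w , dx , dy
splitAtFirstPassage-correct zero    j (d ∷ w) h = refl , _ , h
splitAtFirstPassage-correct (suc t) j (d ∷ w) h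
  with splitAtFirstPassage t w | splitAtFirstPassage-correct t j w h
... | x , y | x++dy≡w , dx , dy = cong (d ∷_) x++dy≡w , dx , dy

splitAtFirstPassage-++ : ∀ t x y → T (descendsFrom t x) → splitAtFirstPassage t (x ++ d ∷ y) ≡ (x , y)
splitAtFirstPassage-++ t       (u ∷ x) y h = cong (map₁ (u ∷_)) (splitAtFirstPassage-++ (suc t) x y h)
splitAtFirstPassage-++ zero    []      y h = refl
splitAtFirstPassage-++ (suc t) (d ∷ x) y h = cong (map₁ (d ∷_)) (splitAtFirstPassage-++ t x y h)

descendsFrom-++ : ∀ t j x y → T (descendsFrom t x) → T (descendsFrom j y) →
  T (descendsFrom (suc (t + j)) (x ++ d ∷ y))
descendsFrom-++ t       j (u ∷ x) y hx hy = descendsFrom-++ (suc t) j x y hx hy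
descendsFrom-++ zero    j []      y hx hy = hy
descendsFrom-++ (suc t) j (d ∷ x) y hx hy = descendsFrom-++ t j x y hx hy

withPeak : List Step × List Step → List Step
withPeak (A , B) = A ++ u ∷ d ∷ B

DyckPeak : List Step × List Step → Set
DyckPeak AB = T (isDyck (fromList (withPeak AB)))

endHeight-prefix : ∀ s A B → T (allNonneg (s ∷ heightsFrom s (fromList (A ++ B)))) →
  Σ[ k ∈ ℕ ] endHeight s (fromList A) ≡ + k
endHeight-prefix (+ k)    []      B _  = k , refl
endHeight-prefix -[1+ _ ] []      B ()
endHeight-prefix s        (x ∷ A) B nn =
  endHeight-prefix (s ℤ.+ stepVal x) A B (proj₂ (Equivalence.to (T-∧ {+ 0 ℤ.≤ᵇ s}) nn))

dyckPeak-base : ∀ A B → DyckPeak (A , B) → Σ[ k ∈ ℕ ] endHeight (+ 0) (fromList A) ≡ + k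
dyckPeak-base A B dyck = endHeight-prefix (+ 0) A (u ∷ d ∷ B)
  (proj₂ (Equivalence.to (T-∧ {isZero (endHeight (+ 0) (fromList (withPeak (A , B))))}) dyck))

isDyck-withPeak : ∀ A B → let e = endHeight (+ 0) (fromList A) in
  isDyck (fromList (withPeak (A , B))) ≡
  isZero (endHeight e (fromList B)) ∧
  (allNonneg (heightsFrom (+ 0) (fromList A)) ∧
   ((+ 0 ℤ.≤ᵇ e ℤ.+ + 1) ∧ ((+ 0 ℤ.≤ᵇ e) ∧ allNonneg (heightsFrom e (fromList B)))))
isDyck-withPeak A B = cong₂ _∧_
  (cong isZero (trans (endHeight-++ (+ 0) A _) (cong (λ t → endHeight t (fromList B)) (stepVal-flipStep e u))))
  (trans (cong allNonneg (heightsFrom-++ (+ 0) A _))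
    (trans (allNonneg-++ (heightsFrom (+ 0) (fromList A)) _)
      (cong (λ t → allNonneg (heightsFrom (+ 0) (fromList A)) ∧
                   ((+ 0 ℤ.≤ᵇ e ℤ.+ + 1) ∧ ((+ 0 ℤ.≤ᵇ t) ∧ allNonneg (heightsFrom t (fromList B)))))
            (stepVal-flipStep e u))))
  where e = endHeight (+ 0) (fromList A)

descendsFrom-reverseFlip : ∀ {k} A → endHeight (+ 0) (fromList A) ≡ + k →
  descendsFrom k (reverseFlip A) ≡ allNonneg (heightsFrom (+ 0) (fromList A))
descendsFrom-reverseFlip {k} A eA = begin
  descendsFrom k (reverseFlip A)
    ≡⟨ descendsFrom-spec k (reverseFlip A) ⟩
  isZero (endHeight (+ k) A′) ∧ allNonneg (+ k ∷ heightsFrom (+ k) A′)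
    ≡⟨ cong (λ t → isZero (endHeight t A′) ∧ allNonneg (t ∷ heightsFrom t A′)) eA ⟨
  isZero (endHeight e A′) ∧ allNonneg (e ∷ heightsFrom e A′)
    ≡⟨ cong₂ (λ t hs → isZero t ∧ allNonneg hs)
             (endHeight-reverseFlip (+ 0) A) (heightsFrom-reverseFlip (+ 0) A) ⟩
  allNonneg (reverse (+ 0 ∷ heightsFrom (+ 0) (fromList A)))
    ≡⟨ allNonneg-reverse (+ 0 ∷ heightsFrom (+ 0) (fromList A)) ⟩
  allNonneg (heightsFrom (+ 0) (fromList A))
    ∎
  where
    open ≡-Reasoning
    e = endHeight (+ 0) (fromList A)
    A′ = fromList (reverseFlip A)

isDyck-withPeak-descendsFrom : ∀ {k} A B → endHeight (+ 0) (fromList A) ≡ + k →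
  isDyck (fromList (withPeak (A , B))) ≡ descendsFrom k (reverseFlip A) ∧ descendsFrom k B
isDyck-withPeak-descendsFrom {k} A B eA = begin
  isDyck (fromList (withPeak (A , B)))         ≡⟨ isDyck-withPeak A B ⟩
  baseAt (endHeight (+ 0) (fromList A))        ≡⟨ cong baseAt eA ⟩
  isZero (endHeight (+ k) B′) ∧ (nnA ∧ allNonneg (heightsFrom (+ k) B′))
    ≡⟨ swap-∧ (isZero (endHeight (+ k) B′)) nnA (allNonneg (heightsFrom (+ k) B′)) ⟩
  nnA ∧ (isZero (endHeight (+ k) B′) ∧ allNonneg (heightsFrom (+ k) B′))
    ≡⟨ cong₂ _∧_ (descendsFrom-reverseFlip A eA) (descendsFrom-spec k B) ⟨
  descendsFrom k (reverseFlip A) ∧ descendsFrom k B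
    ∎
  where
    open ≡-Reasoning
    B′ = fromList B
    nnA = allNonneg (heightsFrom (+ 0) (fromList A))
    baseAt : ℤ → Bool
    baseAt e = isZero (endHeight e B′) ∧
               (nnA ∧ ((+ 0 ℤ.≤ᵇ e ℤ.+ + 1) ∧ ((+ 0 ℤ.≤ᵇ e) ∧ allNonneg (heightsFrom e B′))))
    swap-∧ : ∀ a b c → a ∧ (b ∧ c) ≡ b ∧ (a ∧ c)
    swap-∧ a b c = trans (sym (Bool.∧-assoc a b c)) (trans (cong (_∧ c) (Bool.∧-comm a b)) (Bool.∧-assoc b a c))

dyckPeak⇒descendsFrom : ∀ k A B → endHeight (+ 0) (fromList A) ≡ + k → DyckPeak (A , B) →
  T (descendsFrom k (reverseFlip A)) × T (descendsFrom k B)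
dyckPeak⇒descendsFrom k A B eA dyck =
  Equivalence.to (T-∧ {descendsFrom k (reverseFlip A)}) (subst T (isDyck-withPeak-descendsFrom A B eA) dyck)

descendsFrom⇒dyckPeak : ∀ k x B → T (descendsFrom k x) → T (descendsFrom k B) →
  endHeight (+ 0) (fromList (reverseFlip x)) ≡ + k × DyckPeak (reverseFlip x , B)
descendsFrom⇒dyckPeak k x B dx dB =
  endHeight≡k , subst T (sym (isDyck-withPeak-descendsFrom (reverseFlip x) B endHeight≡k))
  (Equivalence.from (T-∧ {descendsFrom k (reverseFlip (reverseFlip x))})
    (subst (T ∘ descendsFrom k) (sym (reverseFlip-involutive x)) dx , dB))
  where
    endHeight≡k : endHeight (+ 0) (fromList (reverseFlip x)) ≡ + k
    endHeight≡k = begin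
      endHeight (+ 0) (fromList (reverseFlip x))
        ≡⟨ cong (λ t → endHeight t (fromList (reverseFlip x))) (descendsFrom⇒endHeight≡0 k x dx) ⟨
      endHeight (endHeight (+ k) (fromList x)) (fromList (reverseFlip x))
        ≡⟨ endHeight-reverseFlip (+ k) x ⟩
      + k ∎
      where open ≡-Reasoning

-- A state of the transducer reading a path w: `excess` is the height of w above its
-- running minimum M, `odd` the parity of M, and `positive` the side of the axis the
-- output is on.  The output is at height ±(excess + [odd]) (bridgeHeight) and changes
-- side when M drops to an odd level; `level odd c` is M when c such changes remain.
record State : Set where
  constructor state
  field
    positive : Bool
    odd      : Bool
    excess   : ℕ

open State

orient : Bool → Step → Step
orient true  x = x
orient false x = flipStep x

orient-involutive : ∀ σ x → orient σ (orient σ x) ≡ x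
orient-involutive true  x = refl
orient-involutive false x = flipStep-involutive x

next : State → Step → State
next (state σ ρ r)        u = state σ ρ (suc r)
next (state σ ρ (suc r))  d = state σ ρ r
next (state σ true  zero) d = state σ false zero
next (state σ false zero) d = state (not σ) true zero

transduce : State → List Step → List Step
transduce st []      = []
transduce st (x ∷ w) = orient (positive st) x ∷ transduce (next st x) w

untransduce : State → List Step → List Step
untransduce st []      = []
untransduce st (y ∷ q) = x ∷ untransduce (next st x) q
  where x = orient (positive st) y

untransduce-transduce : ∀ st w → untransduce st (transduce st w) ≡ w
untransduce-transduce st []      = refl
untransduce-transduce st (x ∷ w) rewrite orient-involutive (positive st) x =
  cong (x ∷_) (untransduce-transduce (next st x) w)

transduce-untransduce : ∀ st q → transduce st (untransduce st q) ≡ q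
transduce-untransduce st []      = refl
transduce-untransduce st (y ∷ q) rewrite orient-involutive (positive st) y =
  cong (y ∷_) (transduce-untransduce _ q)

length-transduce : ∀ st w → length (transduce st w) ≡ length w
length-transduce st []      = refl
length-transduce st (x ∷ w) = cong suc (length-transduce (next st x) w)

bridgeHeight : State → ℤ
bridgeHeight (state true  true  r)       = + suc r
bridgeHeight (state true  false r)       = + r
bridgeHeight (state false true  r)       = -[1+ r ]
bridgeHeight (state false false zero)    = + 0
bridgeHeight (state false false (suc r)) = -[1+ r ]

bridgeHeight-next : ∀ st x → bridgeHeight st ℤ.+ stepVal (orient (positive st) x) ≡ bridgeHeight (next st x)
bridgeHeight-next (state true  true  r)             u = cong +_ (ℕ.+-comm (suc r) 1)
bridgeHeight-next (state true  false r)             u = cong +_ (ℕ.+-comm r 1)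
bridgeHeight-next (state false true  r)             u = cong -[1+_] (cong suc (ℕ.+-identityʳ r))
bridgeHeight-next (state false false zero)          u = refl
bridgeHeight-next (state false false (suc r))       u = cong -[1+_] (cong suc (ℕ.+-identityʳ r))
bridgeHeight-next (state true  true  (suc r))       d = refl
bridgeHeight-next (state true  false (suc r))       d = refl
bridgeHeight-next (state false true  (suc r))       d = refl
bridgeHeight-next (state false false (suc zero))    d = refl
bridgeHeight-next (state false false (suc (suc r))) d = refl
bridgeHeight-next (state true  true  zero)          d = refl
bridgeHeight-next (state true  false zero)          d = refl
bridgeHeight-next (state false true  zero)          d = refl
bridgeHeight-next (state false false zero)          d = refl

level : Bool → ℕ → ℕ
level true  c = suc (c + c)
level false c = c + c

-- When the output sits on the axis, its previous height a is ±1 on the side `positive`,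
-- so that the next drop of M is seen as a crossing.
Approach : State → ℤ → Set
Approach (state σ     true  r)       a = ⊤
Approach (state σ     false (suc r)) a = ⊤
Approach (state true  false zero)    a = a ≡ + 1
Approach (state false false zero)    a = a ≡ -[1+ 0 ]

isBridgeWith : ℕ → ℤ → State → List Step → Bool
isBridgeWith c a st w = isZero (endHeight z v) ∧ (crossingsL (a ∷ z ∷ heightsFrom z v) ≡ᵇ c)
  where
    z = bridgeHeight st
    v = fromList (transduce st w)

isBridgeAfter : ℕ → ℤ → ℤ → State → List Step → Bool
isBridgeAfter c a z st w = isZero (endHeight z′ v) ∧ (crossingsL (a ∷ z ∷ z′ ∷ heightsFrom z′ v) ≡ᵇ c)
  where
    z′ = bridgeHeight st
    v = fromList (transduce st w)

isBridgeWith-∷ : ∀ c a st x w →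
  isBridgeWith c a st (x ∷ w) ≡ isBridgeAfter c a (bridgeHeight st) (next st x) w
isBridgeWith-∷ c a st x w =
  cong (λ z′ → isZero (endHeight z′ v) ∧ (crossingsL (a ∷ bridgeHeight st ∷ z′ ∷ heightsFrom z′ v) ≡ᵇ c))
       (bridgeHeight-next st x)
  where v = fromList (transduce (next st x) w)

mutual
  descendsFrom-transduce : ∀ w c a st → Approach st a →
    descendsFrom (excess st + level (odd st) c) w ≡ isBridgeWith c a st w
  descendsFrom-transduce [] c       a (state true  true  zero)    _ = refl
  descendsFrom-transduce [] c       a (state true  true  (suc r)) _ = refl
  descendsFrom-transduce [] c       a (state false true  zero)    _ = refl
  descendsFrom-transduce [] c       a (state false true  (suc r)) _ = refl
  descendsFrom-transduce [] zero    a (state true  false zero)    _ = refl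
  descendsFrom-transduce [] zero    a (state false false zero)    _ = refl
  descendsFrom-transduce [] (suc c) a (state σ     false zero)    _ = sym (Bool.∧-zeroʳ _)
  descendsFrom-transduce [] c       a (state true  false (suc r)) _ = refl
  descendsFrom-transduce [] c       a (state false false (suc r)) _ = refl
  descendsFrom-transduce (x ∷ w) c a st ok =
    trans (descendsFrom-transduce-∷ x w c a st ok) (sym (isBridgeWith-∷ c a st x w))

  descendsFrom-transduce-∷ : ∀ x w c a st → Approach st a →
    descendsFrom (excess st + level (odd st) c) (x ∷ w) ≡ isBridgeAfter c a (bridgeHeight st) (next st x) w
  descendsFrom-transduce-∷ u w c a (state true  true  r)       _    = descendsFrom-transduce w c _ _ _
  descendsFrom-transduce-∷ u w c a (state false true  r)       _    = descendsFrom-transduce w c _ _ _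
  descendsFrom-transduce-∷ u w c a (state true  false (suc r)) _    = descendsFrom-transduce w c _ _ _
  descendsFrom-transduce-∷ u w c a (state false false (suc r)) _    = descendsFrom-transduce w c _ _ _
  descendsFrom-transduce-∷ u w c a (state true  false zero)    refl = descendsFrom-transduce w c _ _ _
  descendsFrom-transduce-∷ u w c a (state false false zero)    refl = descendsFrom-transduce w c _ _ _
  descendsFrom-transduce-∷ d w c a (state true  true  (suc r)) _    = descendsFrom-transduce w c _ _ _
  descendsFrom-transduce-∷ d w c a (state false true  (suc r)) _    = descendsFrom-transduce w c _ _ _
  descendsFrom-transduce-∷ d w c a (state true  false (suc zero))    _ = descendsFrom-transduce w c _ _ refl
  descendsFrom-transduce-∷ d w c a (state false false (suc zero))    _ = descendsFrom-transduce w c _ _ refl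
  descendsFrom-transduce-∷ d w c a (state true  false (suc (suc r))) _ = descendsFrom-transduce w c _ _ _
  descendsFrom-transduce-∷ d w c a (state false false (suc (suc r))) _ = descendsFrom-transduce w c _ _ _
  descendsFrom-transduce-∷ d w c a (state true  true  zero)    _    = descendsFrom-transduce w c _ _ refl
  descendsFrom-transduce-∷ d w c a (state false true  zero)    _    = descendsFrom-transduce w c _ _ refl
  descendsFrom-transduce-∷ d w zero    a (state true  false zero) refl = sym (Bool.∧-zeroʳ _)
  descendsFrom-transduce-∷ d w zero    a (state false false zero) refl = sym (Bool.∧-zeroʳ _)
  descendsFrom-transduce-∷ d w (suc c) a (state true  false zero) refl =
    trans (cong (λ t → descendsFrom t w) (ℕ.+-suc c c)) (descendsFrom-transduce w c _ _ _)
  descendsFrom-transduce-∷ d w (suc c) a (state false false zero) refl =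
    trans (cong (λ t → descendsFrom t w) (ℕ.+-suc c c)) (descendsFrom-transduce w c _ _ _)

start : State
start = state false true 0

descendsFrom-transduce-start : ∀ k w → descendsFrom (suc (k + k)) w ≡
  isBridge (fromList (d ∷ transduce start w)) ∧ (crossings (fromList (d ∷ transduce start w)) ≡ᵇ k)
descendsFrom-transduce-start k w = descendsFrom-transduce w k (+ 0) start tt

toBridge : List Step × List Step → List Step
toBridge (A , B) = d ∷ transduce start (reverseFlip A ++ d ∷ B)

fromBridge : List Step → List Step × List Step
fromBridge (d ∷ q) = map₁ reverseFlip (splitAtFirstPassage (crossings (fromList (d ∷ q))) (untransduce start q))
fromBridge _       = [] , []

length-toBridge : ∀ A B → length (toBridge (A , B)) ≡ length (withPeak (A , B))
length-toBridge A B = begin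
  suc (length (transduce start w))                        ≡⟨ cong suc (length-transduce start w) ⟩
  suc (length w)                                          ≡⟨ cong suc (List.length-++ (reverseFlip A)) ⟩
  suc (length (reverseFlip A) + suc (length B))           ≡⟨ cong (λ n → suc (n + _)) (length-reverseFlip A) ⟩
  suc (length A + suc (length B))                         ≡⟨ ℕ.+-suc (length A) (suc (length B)) ⟨
  length A + suc (suc (length B))                         ≡⟨ List.length-++ A ⟨
  length (A ++ u ∷ d ∷ B)                                 ∎
  where
    open ≡-Reasoning
    w = reverseFlip A ++ d ∷ B

module _ {k : ℕ} (A B : List Step) (eA : endHeight (+ 0) (fromList A) ≡ + k) (dyck : DyckPeak (A , B)) where
  private
    w = reverseFlip A ++ d ∷ B
    dA,dB = dyckPeak⇒descendsFrom k A B eA dyck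
    bridge,crossings = Equivalence.to (T-∧ {isBridge (fromList (toBridge (A , B)))})
      (subst T (descendsFrom-transduce-start k w) (descendsFrom-++ k k (reverseFlip A) B (proj₁ dA,dB) (proj₂ dA,dB)))

  toBridge-isBridge : T (isBridge (fromList (toBridge (A , B))))
  toBridge-isBridge = proj₁ bridge,crossings

  crossings-toBridge : crossings (fromList (toBridge (A , B))) ≡ k
  crossings-toBridge = ℕ.≡ᵇ⇒≡ _ k (proj₂ bridge,crossings)

  fromBridge-toBridge : fromBridge (toBridge (A , B)) ≡ (A , B)
  fromBridge-toBridge = begin
    map₁ reverseFlip (splitAtFirstPassage (crossings (fromList (toBridge (A , B)))) (untransduce start (transduce start w)))
      ≡⟨ cong₂ (λ c v → map₁ reverseFlip (splitAtFirstPassage c v))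
               crossings-toBridge (untransduce-transduce start w) ⟩
    map₁ reverseFlip (splitAtFirstPassage k w)
      ≡⟨ cong (map₁ reverseFlip) (splitAtFirstPassage-++ k (reverseFlip A) B (proj₁ dA,dB)) ⟩
    (reverseFlip (reverseFlip A) , B)
      ≡⟨ cong (_, B) (reverseFlip-involutive A) ⟩
    (A , B) ∎
    where open ≡-Reasoning

endHeight-crossings-toBridge : ∀ A B → DyckPeak (A , B) →
  endHeight (+ 0) (fromList A) ≡ + crossings (fromList (toBridge (A , B)))
endHeight-crossings-toBridge A B dyck = trans eA (cong +_ (sym (crossings-toBridge A B eA dyck)))
  where eA = proj₂ (dyckPeak-base A B dyck)

descendsFrom-untransduce : ∀ q → T (isBridge (fromList (d ∷ q))) →
  let k = crossings (fromList (d ∷ q)) in T (descendsFrom (suc (k + k)) (untransduce start q))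
descendsFrom-untransduce q bridge = subst T (sym (begin
  descendsFrom (suc (k + k)) w
    ≡⟨ descendsFrom-transduce-start k w ⟩
  isBridge (fromList (d ∷ transduce start w)) ∧ (crossings (fromList (d ∷ transduce start w)) ≡ᵇ k)
    ≡⟨ cong (λ v → isBridge (fromList (d ∷ v)) ∧ (crossings (fromList (d ∷ v)) ≡ᵇ k))
            (transduce-untransduce start q) ⟩
  isBridge (fromList (d ∷ q)) ∧ (k ≡ᵇ k) ∎))
  (Equivalence.from (T-∧ {isBridge (fromList (d ∷ q))}) (bridge , ℕ.≡⇒≡ᵇ k k refl))
  where
    open ≡-Reasoning
    k = crossings (fromList (d ∷ q))
    w = untransduce start q

fromBridge-correct : ∀ Q → T (isBridge (fromList Q)) → T (firstIsD (fromList Q)) →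
  DyckPeak (fromBridge Q) × toBridge (fromBridge Q) ≡ Q
fromBridge-correct (d ∷ q) bridge _
  with splitAtFirstPassage k (untransduce start q)
     | splitAtFirstPassage-correct k k (untransduce start q) (descendsFrom-untransduce q bridge)
  where k = crossings (fromList (d ∷ q))
... | x , y | x++dy≡w , dx , dy = proj₂ (descendsFrom⇒dyckPeak k x y dx dy) , cong (d ∷_) (begin
  transduce start (reverseFlip (reverseFlip x) ++ d ∷ y)
    ≡⟨ cong (λ x′ → transduce start (x′ ++ d ∷ y)) (reverseFlip-involutive x) ⟩
  transduce start (x ++ d ∷ y)                          ≡⟨ cong (transduce start) x++dy≡w ⟩
  transduce start (untransduce start q)                 ≡⟨ transduce-untransduce start q ⟩
  q                                                     ∎)
  where
    open ≡-Reasoning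
    k = crossings (fromList (d ∷ q))


PeakFactorisation : List Step → Set
PeakFactorisation P = Σ[ AB ∈ List Step × List Step ] withPeak AB ≡ P

peakIndex : ∀ s A B → Fin (length (peakHeightsFrom s (fromList (withPeak (A , B)))))
peakIndex s []          B = zero
peakIndex s (u ∷ [])    B = peakIndex (s ℤ.+ + 1) [] B
peakIndex s (u ∷ u ∷ A) B = peakIndex (s ℤ.+ + 1) (u ∷ A) B
peakIndex s (u ∷ d ∷ A) B = suc (peakIndex (s ℤ.+ + 1) (d ∷ A) B)
peakIndex s (d ∷ A)     B = peakIndex (s ℤ.+ -[1+ 0 ]) A B

lookupL-peakIndex : ∀ s A B →
  lookupL (peakHeightsFrom s (fromList (withPeak (A , B)))) (peakIndex s A B) ≡ endHeight s (fromList A) ℤ.+ + 1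
lookupL-peakIndex s []          B = refl
lookupL-peakIndex s (u ∷ [])    B = refl
lookupL-peakIndex s (u ∷ u ∷ A) B = lookupL-peakIndex (s ℤ.+ + 1) (u ∷ A) B
lookupL-peakIndex s (u ∷ d ∷ A) B = lookupL-peakIndex (s ℤ.+ + 1) (d ∷ A) B
lookupL-peakIndex s (d ∷ A)     B = lookupL-peakIndex (s ℤ.+ -[1+ 0 ]) A B

factorisationIndex : ∀ s {P} → PeakFactorisation P → Fin (length (peakHeightsFrom s (fromList P)))
factorisationIndex s ((A , B) , refl) = peakIndex s A B

consFactorisation : ∀ x {P} → PeakFactorisation P → PeakFactorisation (x ∷ P)
consFactorisation x ((A , B) , e) = (x ∷ A , B) , cong (x ∷_) e

splitAtPeak : ∀ s P → Fin (length (peakHeightsFrom s (fromList P))) → PeakFactorisation P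
splitAtPeak s (u ∷ u ∷ P) i       = consFactorisation u (splitAtPeak (s ℤ.+ + 1) (u ∷ P) i)
splitAtPeak s (u ∷ d ∷ P) zero    = ([] , P) , refl
splitAtPeak s (u ∷ d ∷ P) (suc i) = consFactorisation u (splitAtPeak (s ℤ.+ + 1) (d ∷ P) i)
splitAtPeak s (d ∷ P)     i       = consFactorisation d (splitAtPeak (s ℤ.+ -[1+ 0 ]) P i)

splitAtPeak-peakIndex : ∀ s A B → splitAtPeak s (withPeak (A , B)) (peakIndex s A B) ≡ ((A , B) , refl)
splitAtPeak-peakIndex s []          B = refl
splitAtPeak-peakIndex s (u ∷ [])    B = cong (consFactorisation u) (splitAtPeak-peakIndex (s ℤ.+ + 1) [] B)
splitAtPeak-peakIndex s (u ∷ u ∷ A) B = cong (consFactorisation u) (splitAtPeak-peakIndex (s ℤ.+ + 1) (u ∷ A) B)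
splitAtPeak-peakIndex s (u ∷ d ∷ A) B = cong (consFactorisation u) (splitAtPeak-peakIndex (s ℤ.+ + 1) (d ∷ A) B)
splitAtPeak-peakIndex s (d ∷ A)     B = cong (consFactorisation d) (splitAtPeak-peakIndex (s ℤ.+ -[1+ 0 ]) A B)

factorisationIndex-splitAtPeak : ∀ s P i → factorisationIndex s (splitAtPeak s P i) ≡ i
factorisationIndex-splitAtPeak s (u ∷ u ∷ P) i =
  trans (index-uu (splitAtPeak (s ℤ.+ + 1) (u ∷ P) i)) (factorisationIndex-splitAtPeak (s ℤ.+ + 1) (u ∷ P) i)
  where
    index-uu : (f : PeakFactorisation (u ∷ P)) →
      factorisationIndex s (consFactorisation u f) ≡ factorisationIndex (s ℤ.+ + 1) f
    index-uu (([]    , B) , refl) = refl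
    index-uu ((u ∷ A , B) , refl) = refl
factorisationIndex-splitAtPeak s (u ∷ d ∷ P) zero    = refl
factorisationIndex-splitAtPeak s (u ∷ d ∷ P) (suc i) =
  trans (index-ud (splitAtPeak (s ℤ.+ + 1) (d ∷ P) i)) (cong suc (factorisationIndex-splitAtPeak (s ℤ.+ + 1) (d ∷ P) i))
  where
    index-ud : (f : PeakFactorisation (d ∷ P)) →
      factorisationIndex s (consFactorisation u f) ≡ suc (factorisationIndex (s ℤ.+ + 1) f)
    index-ud ((d ∷ A , B) , refl) = refl
factorisationIndex-splitAtPeak s (d ∷ P) i =
  trans (index-d (splitAtPeak (s ℤ.+ -[1+ 0 ]) P i)) (factorisationIndex-splitAtPeak (s ℤ.+ -[1+ 0 ]) P i)
  where
    index-d : (f : PeakFactorisation P) →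
      factorisationIndex s (consFactorisation d f) ≡ factorisationIndex (s ℤ.+ -[1+ 0 ]) f
    index-d ((A , B) , refl) = refl

peaks↔factorisations : ∀ P → Fin (numPeaks (fromList P)) ↔ PeakFactorisation P
peaks↔factorisations P = mk↔ₛ′ (splitAtPeak (+ 0) P) (factorisationIndex (+ 0))
  (λ { ((A , B) , refl) → splitAtPeak-peakIndex (+ 0) A B }) (factorisationIndex-splitAtPeak (+ 0) P)

MarkedDyckˡ : ℕ → List Step × List Step → Set
MarkedDyckˡ m AB = length (withPeak AB) ≡ m × DyckPeak AB

DBridgeˡ : ℕ → List Step → Set
DBridgeˡ m Q = length Q ≡ m × T (isBridge (fromList Q)) × T (firstIsD (fromList Q))

toBridge-↔ : ∀ m → Σ _ (MarkedDyckˡ m) ↔ Σ _ (DBridgeˡ m)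
toBridge-↔ m = Σ-restrict toBridge fromBridge toBridge-ok fromBridge-ok fromBridge∘toBridge toBridge∘fromBridge
  (λ AB → ×-irrelevant ℕ.≡-irrelevant (T-irrelevant {isDyck (fromList (withPeak AB))}))
  (λ Q → ×-irrelevant ℕ.≡-irrelevant
           (×-irrelevant (T-irrelevant {isBridge (fromList Q)}) (T-irrelevant {firstIsD (fromList Q)})))
  where
    toBridge-ok : ∀ AB → MarkedDyckˡ m AB → DBridgeˡ m (toBridge AB)
    toBridge-ok (A , B) (len , dyck) =
      trans (length-toBridge A B) len , toBridge-isBridge A B (proj₂ (dyckPeak-base A B dyck)) dyck , _
    fromBridge-ok : ∀ Q → DBridgeˡ m Q → MarkedDyckˡ m (fromBridge Q)
    fromBridge-ok Q (len , bridge , first) with fromBridge Q | fromBridge-correct Q bridge first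
    ... | A , B | dyck , toBridge≡Q = trans (sym (length-toBridge A B)) (trans (cong length toBridge≡Q) len) , dyck
    fromBridge∘toBridge : ∀ AB → MarkedDyckˡ m AB → fromBridge (toBridge AB) ≡ AB
    fromBridge∘toBridge (A , B) (_ , dyck) = fromBridge-toBridge A B (proj₂ (dyckPeak-base A B dyck)) dyck
    toBridge∘fromBridge : ∀ Q → DBridgeˡ m Q → toBridge (fromBridge Q) ≡ Q
    toBridge∘fromBridge Q (_ , bridge , first) = proj₂ (fromBridge-correct Q bridge first)

MarkedPath : ℕ → Set
MarkedPath m = Σ (Path m) λ p → T (isDyck p) × Fin (numPeaks p)

DBridgePath : ℕ → Set
DBridgePath m = Σ (Path m) λ q → T (isBridge q) × T (firstIsD q)

peakHeight : ∀ {m} → MarkedPath m → ℤ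
peakHeight (p , _ , i) = lookupL (peakHeights p) i

-- Kept opaque because unfolding these composite bijections is very expensive;
-- only the behaviour of `to` recorded next to each is used.
opaque
  markedˡ↔markedPath : ∀ m → Σ _ (MarkedDyckˡ m) ↔ MarkedPath m
  markedˡ↔markedPath m =
    ↔-trans (Σ-contract withPeak R)
      (↔-trans (Σ-↔ ↔-refl reassoc) (vec↔list (λ p → T (isDyck p) × Fin (numPeaks p))))
    where
      R : List Step → Set
      R P = length P ≡ m × T (isDyck (fromList P))
      reassoc : ∀ {P} → (R P × PeakFactorisation P) ↔
                        (length P ≡ m × T (isDyck (fromList P)) × Fin (numPeaks (fromList P)))
      reassoc {P} = ↔-trans (↔-refl ×-↔ ↔-sym (peaks↔factorisations P)) (×-assoc _ _ _ _)

  peakHeight-markedˡ↔markedPath : ∀ {m} x →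
    peakHeight (Inverse.to (markedˡ↔markedPath m) x) ≡ endHeight (+ 0) (fromList (proj₁ (proj₁ x))) ℤ.+ + 1
  peakHeight-markedˡ↔markedPath ((A , B) , refl , dy) = lookupL-peakIndex (+ 0) A B

opaque
  bridgeˡ↔dBridgePath : ∀ m → Σ _ (DBridgeˡ m) ↔ DBridgePath m
  bridgeˡ↔dBridgePath m = vec↔list (λ q → T (isBridge q) × T (firstIsD q))

  crossings-bridgeˡ↔dBridgePath : ∀ {m} y →
    crossings (proj₁ (Inverse.to (bridgeˡ↔dBridgePath m) y)) ≡ crossings (fromList (proj₁ y))
  crossings-bridgeˡ↔dBridgePath (Q , refl , _) = refl

markedPath↔dBridgePath : ∀ m → MarkedPath m ↔ DBridgePath m
markedPath↔dBridgePath m = ↔-trans (↔-sym (markedˡ↔markedPath m)) (↔-trans (toBridge-↔ m) (bridgeˡ↔dBridgePath m))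

peakHeight-markedPath↔dBridgePath : ∀ {m} x →
  peakHeight x ≡ + suc (crossings (proj₁ (Inverse.to (markedPath↔dBridgePath m) x)))
peakHeight-markedPath↔dBridgePath {m} x = via (Inverse.from listMarked x) x (Inverse.strictlyInverseˡ listMarked x)
  where
    listMarked = markedˡ↔markedPath m
    toBridgePath = ↔-trans (toBridge-↔ m) (bridgeˡ↔dBridgePath m)
    via : ∀ y x → Inverse.to listMarked y ≡ x → peakHeight x ≡ + suc (crossings (proj₁ (Inverse.to toBridgePath y)))
    via y@((A , B) , _ , dyck) _ refl = begin
      peakHeight (Inverse.to listMarked y)              ≡⟨ peakHeight-markedˡ↔markedPath y ⟩
      endHeight (+ 0) (fromList A) ℤ.+ + 1              ≡⟨ cong (ℤ._+ + 1) (endHeight-crossings-toBridge A B dyck) ⟩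
      + (crossings (fromList (toBridge (A , B))) + 1)   ≡⟨ cong +_ (ℕ.+-comm _ 1) ⟩
      + suc (crossings (fromList (toBridge (A , B))))
        ≡⟨ cong (+_ ∘ suc) (crossings-bridgeˡ↔dBridgePath (Inverse.to (toBridge-↔ m) y)) ⟨
      + suc (crossings (proj₁ (Inverse.to toBridgePath y))) ∎
      where open ≡-Reasoning

markedDyck↔dBridge : ∀ n k → MarkedDyck n (suc k) ↔ DBridge n k
markedDyck↔dBridge n k = ↔-trans assocMarked (↔-trans fibres assocBridge)
  where
    m = 2 * n
    e = markedPath↔dBridgePath m
    open Inverse e
    assocMarked : MarkedDyck n (suc k) ↔ Σ (MarkedPath m) (λ x → peakHeight x ≡ + suc k)
    assocMarked = mk↔ₛ′ (λ (p , dy , i , h) → (p , dy , i) , h) (λ ((p , dy , i) , h) → p , dy , i , h)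
      (λ _ → refl) (λ _ → refl)
    assocBridge : Σ (DBridgePath m) (λ y → crossings (proj₁ y) ≡ k) ↔ DBridge n k
    assocBridge = mk↔ₛ′ (λ ((q , b , f) , c) → q , b , f , c) (λ (q , b , f , c) → (q , b , f) , c)
      (λ _ → refl) (λ _ → refl)
    fibres : Σ (MarkedPath m) (λ x → peakHeight x ≡ + suc k) ↔ Σ (DBridgePath m) (λ y → crossings (proj₁ y) ≡ k)
    fibres = Σ-restrict to from
      (λ x h → ℕ.suc-injective (ℤ.+-injective (trans (sym (peakHeight-markedPath↔dBridgePath x)) h)))
      (λ y c → trans (peakHeight-markedPath↔dBridgePath (from y))
                     (cong (+_ ∘ suc) (trans (cong (crossings ∘ proj₁) (strictlyInverseˡ y)) c)))
      (λ x _ → strictlyInverseʳ x) (λ y _ → strictlyInverseˡ y)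
      (λ _ → Decidable⇒UIP.≡-irrelevant ℤ._≟_) (λ _ → ℕ.≡-irrelevant)

Σ-Path-zero : (F : Path 0 → Set) → Σ (Path 0) F ↔ F []
Σ-Path-zero F = mk↔ₛ′ (λ { ([] , x) → x }) ([] ,_) (λ _ → refl) (λ { ([] , x) → refl })

Σ-Path-suc : ∀ {m} (F : Path (suc m) → Set) →
  Σ (Path (suc m)) F ↔ (Σ (Path m) (F ∘ (u ∷_)) ⊎ Σ (Path m) (F ∘ (d ∷_)))
Σ-Path-suc {m} F = mk↔ₛ′ to from
  (λ { (inj₁ _) → refl ; (inj₂ _) → refl }) (λ { (u ∷ p , _) → refl ; (d ∷ p , _) → refl })
  where
    to : Σ (Path (suc m)) F → Σ (Path m) (F ∘ (u ∷_)) ⊎ Σ (Path m) (F ∘ (d ∷_))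
    to (u ∷ p , x) = inj₁ (p , x)
    to (d ∷ p , x) = inj₂ (p , x)
    from : Σ (Path m) (F ∘ (u ∷_)) ⊎ Σ (Path m) (F ∘ (d ∷_)) → Σ (Path (suc m)) F
    from (inj₁ (p , x)) = u ∷ p , x
    from (inj₂ (p , x)) = d ∷ p , x

sum-allPaths-suc : ∀ {m} (wt : Path (suc m) → ℕ) →
  sum (map wt (allPaths (suc m))) ≡ sum (map (wt ∘ (u ∷_)) (allPaths m)) + sum (map (wt ∘ (d ∷_)) (allPaths m))
sum-allPaths-suc {m} wt = begin
  sum (map wt (map (u ∷_) ps ++ map (d ∷_) ps))           ≡⟨ cong sum (List.map-++ wt (map (u ∷_) ps) _) ⟩
  sum (map wt (map (u ∷_) ps) ++ map wt (map (d ∷_) ps))  ≡⟨ sum-++ (map wt (map (u ∷_) ps)) _ ⟩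
  sum (map wt (map (u ∷_) ps)) + sum (map wt (map (d ∷_) ps))
    ≡⟨ cong₂ (λ xs ys → sum xs + sum ys) (List.map-∘ ps) (List.map-∘ ps) ⟨
  sum (map (wt ∘ (u ∷_)) ps) + sum (map (wt ∘ (d ∷_)) ps) ∎
  where
    open ≡-Reasoning
    ps = allPaths m

Fin-sum-allPaths : ∀ m (wt : Path m → ℕ) → Fin (sum (map wt (allPaths m))) ↔ Σ (Path m) (Fin ∘ wt)
Fin-sum-allPaths zero wt = begin
  Fin (wt [] + 0)       ≡⟨ cong Fin (ℕ.+-identityʳ (wt [])) ⟩
  Fin (wt [])           ↔⟨ Σ-Path-zero (Fin ∘ wt) ⟨
  Σ (Path 0) (Fin ∘ wt) ∎
  where open Related.EquationalReasoning {k = Related.bijection}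
Fin-sum-allPaths (suc m) wt = begin
  Fin (sum (map wt (allPaths (suc m))))                       ≡⟨ cong Fin (sum-allPaths-suc wt) ⟩
  Fin (sum (map (wt ∘ (u ∷_)) ps) + sum (map (wt ∘ (d ∷_)) ps)) ↔⟨ Fin.+↔⊎ ⟩
  (Fin (sum (map (wt ∘ (u ∷_)) ps)) ⊎ Fin (sum (map (wt ∘ (d ∷_)) ps))) ↔⟨ Fin-sum-allPaths m _ ⊎-↔ Fin-sum-allPaths m _ ⟩
  (Σ (Path m) (Fin ∘ wt ∘ (u ∷_)) ⊎ Σ (Path m) (Fin ∘ wt ∘ (d ∷_))) ↔⟨ Σ-Path-suc (Fin ∘ wt) ⟨
  Σ (Path (suc m)) (Fin ∘ wt) ∎
  where
    open Related.EquationalReasoning {k = Related.bijection}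
    ps = allPaths m

totalPeaks↔markedPath : ∀ n → Fin (totalPeaks n) ↔ MarkedPath (2 * n)
totalPeaks↔markedPath n = begin
  Fin (totalPeaks n)                        ≡⟨ cong Fin (sum-filter isDyck numPeaks (allPaths (2 * n))) ⟩
  Fin (sum (map weight (allPaths (2 * n)))) ↔⟨ Fin-sum-allPaths (2 * n) weight ⟩
  Σ (Path (2 * n)) (Fin ∘ weight)           ↔⟨ Σ-↔ ↔-refl (λ {p} → Fin-if (isDyck p) (numPeaks p)) ⟩
  MarkedPath (2 * n)                        ∎
  where
    open Related.EquationalReasoning {k = Related.bijection}
    weight : Path (2 * n) → ℕ
    weight p = if isDyck p then numPeaks p else 0

ups : ∀ {m} → Path m → ℕ
ups []      = 0
ups (u ∷ p) = suc (ups p)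
ups (d ∷ p) = ups p

downs : ∀ {m} → Path m → ℕ
downs []      = 0
downs (u ∷ p) = downs p
downs (d ∷ p) = suc (downs p)

ups+downs : ∀ {m} (p : Path m) → ups p + downs p ≡ m
ups+downs []      = refl
ups+downs (u ∷ p) = cong suc (ups+downs p)
ups+downs (d ∷ p) = trans (ℕ.+-suc (ups p) (downs p)) (cong suc (ups+downs p))

endHeight-ups-downs : ∀ {m} s (p : Path m) → endHeight s p ℤ.+ + downs p ≡ s ℤ.+ + ups p
endHeight-ups-downs s []      = refl
endHeight-ups-downs s (u ∷ p) = trans (endHeight-ups-downs (s ℤ.+ + 1) p) (ℤ.+-assoc s (+ 1) (+ ups p))
endHeight-ups-downs s (d ∷ p) = begin
  e ℤ.+ (+ 1 ℤ.+ + downs p)          ≡⟨ cong (λ t → e ℤ.+ t) (ℤ.+-comm (+ 1) (+ downs p)) ⟩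
  e ℤ.+ (+ downs p ℤ.+ + 1)          ≡⟨ ℤ.+-assoc e (+ downs p) (+ 1) ⟨
  e ℤ.+ + downs p ℤ.+ + 1            ≡⟨ cong (ℤ._+ + 1) (endHeight-ups-downs s′ p) ⟩
  s′ ℤ.+ + ups p ℤ.+ + 1             ≡⟨ ℤ.+-assoc s′ (+ ups p) (+ 1) ⟩
  s′ ℤ.+ (+ ups p ℤ.+ + 1)           ≡⟨ cong (λ t → s′ ℤ.+ t) (ℤ.+-comm (+ ups p) (+ 1)) ⟩
  s′ ℤ.+ (+ 1 ℤ.+ + ups p)           ≡⟨ ℤ.+-assoc s′ (+ 1) (+ ups p) ⟨
  s′ ℤ.+ + 1 ℤ.+ + ups p             ≡⟨ cong (ℤ._+ + ups p) (stepVal-flipStep s d) ⟩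
  s ℤ.+ + ups p                      ∎
  where
    open ≡-Reasoning
    s′ = s ℤ.+ -[1+ 0 ]
    e = endHeight s′ p

returnsFromBelow⇔ups : ∀ {m} j → suc m ≡ 2 * j → (p : Path m) →
  T (isZero (endHeight -[1+ 0 ] p)) ⇔ ups p ≡ j
returnsFromBelow⇔ups {m} j m+1≡2j p = mk⇔ returns⇒ups ups⇒returns
  where
    balance : endHeight -[1+ 0 ] p ℤ.+ + downs p ≡ -[1+ 0 ] ℤ.+ + ups p
    balance = endHeight-ups-downs -[1+ 0 ] p
    twice-suc : ∀ i → 2 * suc i ≡ suc (suc (i + i))
    twice-suc i = trans (ℕ.*-suc 2 i) (cong (λ t → suc (suc (i + t))) (ℕ.+-identityʳ i))
    returns⇒ups : T (isZero (endHeight -[1+ 0 ] p)) → ups p ≡ j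
    returns⇒ups h with ups p | trans (sym (cong (ℤ._+ + downs p) (isZero⇒≡0 h))) balance | ups+downs p
    ... | zero  | () | _
    ... | suc i | +downs≡+i | i+1+downs≡m = ℕ.*-cancelˡ-≡ (suc i) j 2 (begin
      2 * suc i             ≡⟨ twice-suc i ⟩
      suc (suc (i + i))     ≡⟨ cong (λ t → suc (suc (i + t))) (ℤ.+-injective +downs≡+i) ⟨
      suc (suc i + downs p) ≡⟨ cong suc i+1+downs≡m ⟩
      suc m                 ≡⟨ m+1≡2j ⟩
      2 * j                 ∎)
      where open ≡-Reasoning
    ups⇒returns : ups p ≡ j → T (isZero (endHeight -[1+ 0 ] p))
    ups⇒returns ups≡j with ups p | balance | ups+downs p | trans m+1≡2j (cong (2 *_) (sym ups≡j))
    ... | suc i | balance′ | i+1+downs≡m | m+1≡2i+2 = subst (T ∘ isZero) (sym endHeight≡0) tt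
      where
        downs≡i : downs p ≡ i
        downs≡i = ℕ.+-cancelˡ-≡ (suc i) (downs p) _
          (ℕ.suc-injective (trans (cong suc i+1+downs≡m) (trans m+1≡2i+2 (twice-suc i))))
        endHeight≡0 : endHeight -[1+ 0 ] p ≡ + 0
        endHeight≡0 = ℤ-identityˡ-unique (endHeight -[1+ 0 ] p) (+ i)
          (subst (λ t → endHeight -[1+ 0 ] p ℤ.+ + t ≡ + i) downs≡i balance′)

ups-binomial : ∀ m j → Σ (Path m) (λ p → ups p ≡ j) ↔ Fin (m C j)
ups-binomial zero    zero    = mk↔ₛ′ (λ _ → zero) (λ _ → [] , refl) (λ { zero → refl }) (λ { ([] , refl) → refl })
ups-binomial zero    (suc j) = mk↔ₛ′ (λ { ([] , ()) }) (λ ()) (λ ()) (λ { ([] , ()) })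
ups-binomial (suc m) zero    = ↔-trans downFirst (ups-binomial m zero)
  where
    downFirst : Σ (Path (suc m)) (λ p → ups p ≡ 0) ↔ Σ (Path m) (λ p → ups p ≡ 0)
    downFirst = mk↔ₛ′ (λ { (d ∷ p , e) → p , e }) (λ (p , e) → d ∷ p , e) (λ _ → refl) (λ { (d ∷ p , e) → refl })
ups-binomial (suc m) (suc j) = begin
  Σ (Path (suc m)) (λ p → ups p ≡ suc j)                          ↔⟨ firstStep ⟩
  (Σ (Path m) (λ p → ups p ≡ j) ⊎ Σ (Path m) (λ p → ups p ≡ suc j)) ↔⟨ ups-binomial m j ⊎-↔ ups-binomial m (suc j) ⟩
  (Fin (m C j) ⊎ Fin (m C suc j))                                 ↔⟨ Fin.+↔⊎ ⟨
  Fin (m C j + m C suc j)                                         ≡⟨ cong Fin (nCk+nC[k+1]≡[n+1]C[k+1] m j) ⟩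
  Fin (suc m C suc j)                                             ∎
  where
    open Related.EquationalReasoning {k = Related.bijection}
    firstStep : Σ (Path (suc m)) (λ p → ups p ≡ suc j) ↔
                (Σ (Path m) (λ p → ups p ≡ j) ⊎ Σ (Path m) (λ p → ups p ≡ suc j))
    firstStep = mk↔ₛ′
      (λ { (u ∷ p , e) → inj₁ (p , ℕ.suc-injective e) ; (d ∷ p , e) → inj₂ (p , e) })
      (λ { (inj₁ (p , e)) → u ∷ p , cong suc e ; (inj₂ (p , e)) → d ∷ p , e })
      (λ { (inj₁ (p , refl)) → refl ; (inj₂ _) → refl })
      (λ { (u ∷ p , refl) → refl ; (d ∷ p , _) → refl })

dBridgePath↔binomial : ∀ n → DBridgePath (2 * suc n) ↔ Fin ((2 * suc n ∸ 1) C suc n)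
dBridgePath↔binomial n = begin
  DBridgePath (suc M)                            ↔⟨ downFirst ⟩
  Σ (Path M) (λ q → T (isBridge (d ∷ q)))        ↔⟨ returns↔ups ⟩
  Σ (Path M) (λ q → ups q ≡ suc n)               ↔⟨ ups-binomial M (suc n) ⟩
  Fin (M C suc n)                                ∎
  where
    open Related.EquationalReasoning {k = Related.bijection}
    M = 2 * suc n ∸ 1
    downFirst : DBridgePath (suc M) ↔ Σ (Path M) (λ q → T (isBridge (d ∷ q)))
    downFirst = mk↔ₛ′ (λ { (d ∷ q , b , _) → q , b }) (λ (q , b) → d ∷ q , b , tt)
      (λ _ → refl) (λ { (d ∷ q , b , _) → refl })
    returns↔ups : Σ (Path M) (λ q → T (isBridge (d ∷ q))) ↔ Σ (Path M) (λ q → ups q ≡ suc n)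
    returns↔ups = Σ-restrict id id
      (λ q → Equivalence.to (returnsFromBelow⇔ups (suc n) refl q))
      (λ q → Equivalence.from (returnsFromBelow⇔ups (suc n) refl q))
      (λ _ _ → refl) (λ _ _ → refl) (λ q → T-irrelevant) (λ _ → ℕ.≡-irrelevant)

totalPeaks-suc : ∀ n → totalPeaks (suc n) ≡ (2 * suc n ∸ 1) C suc n
totalPeaks-suc n = ↔⇒≡ (↔-trans (totalPeaks↔markedPath (suc n))
                        (↔-trans (markedPath↔dBridgePath (2 * suc n)) (dBridgePath↔binomial n)))

theorem3p1 : (n h : ℕ) → n ≥ 1 → h ≥ 1 →
    (MarkedDyck n h ⤖ DBridge n (h ∸ 1)) × (totalPeaks n ≡ (2 * n ∸ 1) C n)
theorem3p1 (suc n) (suc k) _ _ = ↔⇒⤖ (markedDyck↔dBridge (suc n) k) , totalPeaks-suc n
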